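{- Let $a_1,\dots,a_n$ be positive integers with $\gcd(a_1,\dots,a_n)=1$ whose sum $m$ is not a power of two, and let $P=(p_1,\dots,p_n)$ with $p_i=a_i/m$. Write $m=2^u x$ with $x>1$ odd and $u\ge0$, and let $\ell$ be the multiplicative order of $2$ modulo $x$. Let $q_i=c\,a_i/2^{u+\ell}$ where $c=\lfloor 2^{u+\ell}/m\rfloor$. The following are equivalent: (1) for some integer $K$ with $\lceil\log m\rceil\le K\le u+\ell$, the tree $\mathrm{ALDR}[P,K]$ is entropy optimal; (2) $\mathrm{ALDR}[P,u+\ell]$ is entropy optimal; (3) for all $1\le i\le n$, $(1-z^\ell)\sum_d \epsilon_d(p_i)z^d=\sum_d\epsilon_d(q_i)z^d$ as formal power series; (4) for all $1\le i\le n$, the formal power series $(1-z^\ell)\sum_d\epsilon_d(p_i)z^d$ has only nonnegative coefficients; (5) for all $d\ge1$ and $1\le i\le n$, $\epsilon_d(p_i)\le\epsilon_{d+\ell}(p_i)$.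
   Context: All logarithms are base 2. For real $x\ge0$ and integer $d$, $\epsilon_d(x)=\lfloor2^dx\rfloor\bmod2$ (the $d$th binary digit after the point for $x\in[0,1)$), and $\nu(x)=\sum_d d\,\epsilon_d(x)2^{ -d}$. A DDG tree is a sampler driven by i.i.d. fair bits: a binary tree (possibly with back edges to the root) with labeled leaves traversed from the root one fair bit per step until a leaf is reached, whose label is output. A DDG tree with output distribution $P$ is entropy optimal if its expected number of consumed bits is minimal among all DDG trees with output distribution $P$; equivalently, after unrolling all back edges, it has exactly $\epsilon_d(p_i)$ leaves labeled $i$ at depth $d$ for every $i$ and $d$. FLDR: for positive integers $A_1,\dots,A_n$ with sum $M$, $K'=\lceil\log M\rceil$, $A_0=2^{K'}-M$, $Q=(A_0/2^{K'},\dots,A_n/2^{K'})$; $\mathrm{FLDR}[A_1,\dots,A_n]$ is an entropy-optimal DDG tree for $Q$ (exactly $\epsilon_d(A_i/2^{K'})$ leaves labeled $i$ at depth $d$) with every leaf labeled $0$ replaced by a back edge to the root; its output distribution is $(A_i/M)$. For integer $K\ge\lceil\log m\rceil$, $c_K=\lfloor2^K/m\rfloor$ and $\mathrm{ALDR}[P,K]=\mathrm{FLDR}[c_Ka_1,\dots,c_Ka_n]$. -}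

module Defs where

open import Data.Nat using (ℕ; zero; suc; _+_; _*_; _∸_; _^_; _≤_; _<_; _%_; _/_; _≡ᵇ_)
open import Data.Nat.GCD using (gcd)
open import Data.Nat.Logarithm using (⌈log₂_⌉)
open import Data.Fin using (Fin)
open import Data.Vec.Functional using (foldr)
open import Data.Integer as ℤ using (ℤ; +_)
open import Data.Bool using (if_then_else_)
open import Data.Product using (_×_)
open import Relation.Binary.PropositionalEquality using (_≡_; _≢_)

sumF : ∀ {n} → (Fin n → ℕ) → ℕ
sumF = foldr _+_ 0

gcdF : ∀ {n} → (Fin n → ℕ) → ℕ
gcdF = foldr gcd 0

-- Binary digits of a rational a / b (b > 0):
-- ε_d(a/b) = ⌊2^d a / b⌋ mod 2.  (Value for b = 0 is an irrelevant 0.)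

ε : ℕ → ℕ → ℕ → ℕ
ε d a zero    = 0
ε d a (suc b) = ((2 ^ d * a) / suc b) % 2

-- Formal power series in z with integer coefficients: d ↦ coefficient of z^d

Series : Set
Series = ℕ → ℤ

Σ≤ : (ℕ → ℤ) → ℕ → ℤ
Σ≤ f zero    = f zero
Σ≤ f (suc d) = Σ≤ f d ℤ.+ f (suc d)

_⋆_ : Series → Series → Series
(f ⋆ g) d = Σ≤ (λ k → f k ℤ.* g (d ∸ k)) d

one : Series
one d = if d ≡ᵇ 0 then + 1 else + 0

_^ˢ_ : Series → ℕ → Series
f ^ˢ zero  = one
f ^ˢ suc j = f ⋆ (f ^ˢ j)

oneMinusZ^ : ℕ → Series
oneMinusZ^ ℓ d = one d ℤ.- (if d ≡ᵇ ℓ then + 1 else + 0)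

digits : ℕ → ℕ → Series
digits a b d = + ε d a b

IsOrder2 : ℕ → ℕ → Set
IsOrder2 x ℓ = (1 ≤ ℓ) × ((2 ^ ℓ) % suc (x ∸ 1) ≡ 1)
             × (∀ k → 1 ≤ k → k < ℓ → (2 ^ k) % suc (x ∸ 1) ≢ 1)

-- The tree has
-- ε_d(A_i/2^K') leaves labelled i at depth d; label-0 leaves are back
-- edges to the root.  After unrolling the back edges, the number of
-- leaves labelled i at depth d is the number of root-to-leaf paths
-- passing through j ≥ 0 back edges, i.e. the coefficient of z^d in
-- F_i(z) · Σ_j F_0(z)^j, where F_i(z) = Σ_d ε_d(A_i/2^K') z^d.
-- Since F_0 has zero constant term, only j ≤ d contribute.

module FLDR {n : ℕ} (A : Fin n → ℕ) where
  M : ℕ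
  M = sumF A

  K′ : ℕ
  K′ = ⌈log₂ M ⌉

  A₀ : ℕ
  A₀ = 2 ^ K′ ∸ M

  F : Fin n → Series
  F i = digits (A i) (2 ^ K′)

  F₀ : Series
  F₀ = digits A₀ (2 ^ K′)

  unrolledLeaves : Fin n → ℕ → ℤ
  unrolledLeaves i d = Σ≤ (λ j → (F i ⋆ (F₀ ^ˢ j)) d) d

cK : ℕ → ℕ → ℕ
cK K m = 2 ^ K / suc (m ∸ 1)

ALDRleaves : ∀ {n} → (Fin n → ℕ) → ℕ → Fin n → ℕ → ℤ
ALDRleaves a K = FLDR.unrolledLeaves (λ i → cK K (sumF a) * a i)

-- A DDG tree for P is entropy optimal iff, after unrolling all back
-- edges, it has exactly ε_d(p_i) leaves labelled i at depth d.
ALDR-EntropyOptimal : ∀ {n} → (Fin n → ℕ) → ℕ → Set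
ALDR-EntropyOptimal a K =
  ∀ i d → ALDRleaves a K i d ≡ + ε d (a i) (sumF a)

-- Write 2^ℓ = 1 + k x. Then 2^(u+ℓ) = c m + 2^u, so ALDR[P,u+ℓ] has back-edge mass
-- 2^u / 2^(u+ℓ) = z^ℓ and the unrolled tree for label i has generating function Q_i / (1 - z^ℓ),
-- with Q_i the digit series of q_i; this is (2) ⇔ (3). (3) ⇒ (4) is trivial and (4) ⇔ (5) is
-- coefficientwise. For (4) ⇒ (3), the coefficients of (1 - z^ℓ) P_i are bits, the integer they
-- spell up to position D is ⌊2^D p_i⌋ - ⌊2^(D-ℓ) p_i⌋, and for D ≥ u + ℓ this is ⌊2^D q_i⌋, so
-- both bit strings coincide. For (1) ⇒ (2): in an entropy-optimal tree every label has at most one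
-- leaf per depth, while two back edges at distinct depths s ≠ t would give two paths of length
-- p + s t; so the back-edge mass is 2^-s and the total weight is M = 2^w (2^s - 1) with K′ = w + s.
-- As x ∣ M we get ℓ ≤ s, as 2^u ∣ M we get u ≤ w, hence K ≥ K′ ≥ u + ℓ.

module Submission where

open import Defs
open import Data.Nat using (ℕ; _+_; _*_; _^_; _≤_; _<_; _%_)
open import Data.Nat.Logarithm using (⌈log₂_⌉)
open import Data.Fin using (Fin)
open import Data.Integer as ℤ using (+_)
open import Data.Product using (_×_; ∃-syntax)
open import Relation.Nullary using (¬_)
open import Relation.Binary.PropositionalEquality using (_≡_)
open import Function.Bundles using (_⇔_)

open import Data.Nat
  using (zero; suc; _∸_; z≤n; s≤s; s≤s⁻¹; _≡ᵇ_; _≤?_; _≟_; NonZero; >-nonZero; _/_; ⌈_/2⌉; ⌊_/2⌋)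
open import Data.Nat.Properties
open import Data.Nat.DivMod
open import Data.Nat.Induction using (<-rec)
open import Data.Nat.Logarithm using (⌈log₂⌉-mono-≤; ⌈log₂⌈n/2⌉⌉≡⌈log₂n⌉∸1; ⌈log₂2^n⌉≡n)
open import Data.Nat.Divisibility
  using (_∣_; divides; n∣m*n; m∣m*n; ∣n⇒∣m*n; n∣m⇒m%n≡0; ∣m+n∣m⇒∣n; ∣⇒≤; ∣1⇒≡1)
open import Data.Nat.Coprimality using (Coprime; coprime-divisor)
open import Data.Nat.Primality using (irreducible[2])
open import Data.Nat.GCD using (gcd-identityʳ)
open import Data.Integer using (ℤ; 0ℤ; +≤+)
import Data.Integer.Properties as ℤ
open import Data.Integer.Tactic.RingSolver using (solve-∀)
open import Data.Nat.Tactic.RingSolver using () renaming (solve-∀ to ℕ-solve-∀)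
open import Data.Bool using (T; true; false; if_then_else_)
open import Data.Fin using (zero; suc; fromℕ<)
open import Data.Product using (_,_; proj₁; proj₂)
open import Data.Sum using (_⊎_; inj₁; inj₂)
open import Data.Empty using (⊥-elim)
open import Relation.Nullary using (Dec; yes; no)
open import Relation.Binary.PropositionalEquality
open import Relation.Binary.Definitions using (Tri; tri<; tri≈; tri>)
open import Function using (_∘_)
open import Function.Bundles using (mk⇔; Equivalence)
import Function.Properties.Equivalence as ⇔

i+j-j≡i : ∀ a b → a ℤ.+ b ℤ.- b ≡ a
i+j-j≡i = solve-∀

i-j+j≡i : ∀ a b → a ℤ.- b ℤ.+ b ≡ a
i-j+j≡i = solve-∀

*-nonneg : ∀ {a b} → 0ℤ ℤ.≤ a → 0ℤ ℤ.≤ b → 0ℤ ℤ.≤ a ℤ.* b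
*-nonneg {+ a} {+ b} _ _ = subst (0ℤ ℤ.≤_) (ℤ.pos-* a b) (+≤+ z≤n)

1≤* : ∀ {a b} → + 1 ℤ.≤ a → + 1 ℤ.≤ b → + 1 ℤ.≤ a ℤ.* b
1≤* {+ a} {+ b} (+≤+ 1≤a) (+≤+ 1≤b) = subst (+ 1 ℤ.≤_) (ℤ.pos-* a b) (+≤+ (*-mono-≤ 1≤a 1≤b))

Nonneg : (ℕ → ℤ) → Set
Nonneg f = ∀ k → 0ℤ ℤ.≤ f k

-- Finite sums


Σ≤-cong : ∀ {f g} d → (∀ k → k ≤ d → f k ≡ g k) → Σ≤ f d ≡ Σ≤ g d
Σ≤-cong zero    f≡g = f≡g 0 z≤n
Σ≤-cong (suc d) f≡g =
  cong₂ ℤ._+_ (Σ≤-cong d (λ k → f≡g k ∘ m≤n⇒m≤1+n)) (f≡g (suc d) ≤-refl)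

Σ≤-≡0 : ∀ {f} d → (∀ k → k ≤ d → f k ≡ 0ℤ) → Σ≤ f d ≡ 0ℤ
Σ≤-≡0 zero    f≡0 = f≡0 0 z≤n
Σ≤-≡0 (suc d) f≡0 =
  cong₂ ℤ._+_ (Σ≤-≡0 d (λ k → f≡0 k ∘ m≤n⇒m≤1+n)) (f≡0 (suc d) ≤-refl)

Σ≤-single : ∀ {f} d k₀ → k₀ ≤ d → (∀ k → k ≤ d → k ≢ k₀ → f k ≡ 0ℤ) → Σ≤ f d ≡ f k₀
Σ≤-single zero    .zero z≤n _ = refl
Σ≤-single {f} (suc d) k₀ k₀≤ others with k₀ ≟ suc d
... | yes refl = trans
  (cong (ℤ._+ f (suc d)) (Σ≤-≡0 d λ k k≤d → others k (m≤n⇒m≤1+n k≤d) (<⇒≢ (s≤s k≤d))))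
  (ℤ.+-identityˡ _)
... | no k₀≢ = trans
  (cong₂ ℤ._+_ (Σ≤-single d k₀ (s≤s⁻¹ (≤∧≢⇒< k₀≤ k₀≢)) (λ k → others k ∘ m≤n⇒m≤1+n))
               (others (suc d) ≤-refl (k₀≢ ∘ sym)))
  (ℤ.+-identityʳ _)

Σ≤-head : ∀ f d → Σ≤ f (suc d) ≡ f 0 ℤ.+ Σ≤ (f ∘ suc) d
Σ≤-head f zero    = refl
Σ≤-head f (suc d) = trans (cong (ℤ._+ f (suc (suc d))) (Σ≤-head f d)) (ℤ.+-assoc (f 0) _ _)

Σ≤-truncate : ∀ {f} e d → e ≤ d → (∀ j → e < j → j ≤ d → f j ≡ 0ℤ) → Σ≤ f d ≡ Σ≤ f e
Σ≤-truncate e zero    z≤n _ = refl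
Σ≤-truncate e (suc d) e≤ tail≡0 with e ≟ suc d
... | yes refl = refl
... | no e≢ = trans
  (cong₂ ℤ._+_ (Σ≤-truncate e d e≤d (λ j e<j → tail≡0 j e<j ∘ m≤n⇒m≤1+n))
               (tail≡0 (suc d) (s≤s e≤d) ≤-refl))
  (ℤ.+-identityʳ _)
  where
  e≤d : e ≤ d
  e≤d = s≤s⁻¹ (≤∧≢⇒< e≤ e≢)

Σ≤-distrib-- : ∀ f g d → Σ≤ (λ k → f k ℤ.- g k) d ≡ Σ≤ f d ℤ.- Σ≤ g d
Σ≤-distrib-- f g zero    = refl
Σ≤-distrib-- f g (suc d) =
  trans (cong (ℤ._+ (f (suc d) ℤ.- g (suc d))) (Σ≤-distrib-- f g d))
        (regroup (Σ≤ f d) (Σ≤ g d) (f (suc d)) (g (suc d)))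
  where
  regroup : ∀ a b c e → (a ℤ.- b) ℤ.+ (c ℤ.- e) ≡ (a ℤ.+ c) ℤ.- (b ℤ.+ e)
  regroup = solve-∀

Σ≤-nonneg : ∀ {f} → Nonneg f → Nonneg (Σ≤ f)
Σ≤-nonneg f≥0 zero    = f≥0 0
Σ≤-nonneg f≥0 (suc d) = ℤ.+-mono-≤ (Σ≤-nonneg f≥0 d) (f≥0 (suc d))

Σ≤-mono-≤ : ∀ {f} → Nonneg f → ∀ {e d} → e ≤ d → Σ≤ f e ℤ.≤ Σ≤ f d
Σ≤-mono-≤ f≥0 {e} {zero}  z≤n = ℤ.≤-refl
Σ≤-mono-≤ {f} f≥0 {e} {suc d} e≤ with e ≟ suc d
... | yes refl = ℤ.≤-refl
... | no e≢ = ℤ.≤-trans (Σ≤-mono-≤ f≥0 (s≤s⁻¹ (≤∧≢⇒< e≤ e≢)))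
                       (ℤ.i≤i+j _ (f (suc d)) {{ℤ.nonNegative (f≥0 (suc d))}})

term≤Σ≤ : ∀ {f} → Nonneg f → ∀ {k d} → k ≤ d → f k ℤ.≤ Σ≤ f d
term≤Σ≤ f≥0 {zero}  k≤d = Σ≤-mono-≤ f≥0 k≤d
term≤Σ≤ {f} f≥0 {suc k} k≤d =
  ℤ.≤-trans (ℤ.i≤j+i (f (suc k)) _ {{ℤ.nonNegative (Σ≤-nonneg f≥0 k)}})
            (Σ≤-mono-≤ f≥0 k≤d)

two-terms≤Σ≤ : ∀ {f} → Nonneg f → ∀ {j k d} → j < k → k ≤ d → f j ℤ.+ f k ℤ.≤ Σ≤ f d
two-terms≤Σ≤ f≥0 {k = suc k} (s≤s j≤k) k≤d =
  ℤ.≤-trans (ℤ.+-monoˡ-≤ _ (term≤Σ≤ f≥0 j≤k)) (Σ≤-mono-≤ f≥0 k≤d)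

distinct-terms≤Σ≤ : ∀ {f} → Nonneg f → ∀ {j k d} → j ≢ k → j ≤ d → k ≤ d
  → f j ℤ.+ f k ℤ.≤ Σ≤ f d
distinct-terms≤Σ≤ {f} f≥0 {j} {k} {d} j≢k j≤d k≤d with <-cmp j k
... | tri< j<k _ _ = two-terms≤Σ≤ f≥0 j<k k≤d
... | tri≈ _ j≡k _ = ⊥-elim (j≢k j≡k)
... | tri> _ _ k<j = subst (ℤ._≤ Σ≤ f d) (ℤ.+-comm (f k) (f j)) (two-terms≤Σ≤ f≥0 k<j j≤d)

-- Formal power series

infix 25 z^_
z^_ : ℕ → Series
(z^ t) d = if d ≡ᵇ t then + 1 else + 0

z^-diag : ∀ t → (z^ t) t ≡ + 1
z^-diag t with t ≡ᵇ t in eq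
... | true  = refl
... | false = ⊥-elim (subst T eq (≡⇒≡ᵇ t t refl))

z^-off : ∀ {t d} → d ≢ t → (z^ t) d ≡ 0ℤ
z^-off {t} {d} d≢t with d ≡ᵇ t in eq
... | true  = ⊥-elim (d≢t (≡ᵇ⇒≡ d t (subst T (sym eq) _)))
... | false = refl

z^-nonneg : ∀ t → Nonneg (z^ t)
z^-nonneg t d with d ≡ᵇ t
... | true  = +≤+ z≤n
... | false = +≤+ z≤n

shift : ℕ → Series → Series
shift t g d with t ≤? d
... | yes _ = g (d ∸ t)
... | no  _ = 0ℤ

shift-≤ : ∀ {t d} g → t ≤ d → shift t g d ≡ g (d ∸ t)
shift-≤ {t} {d} g t≤d with t ≤? d
... | yes _   = refl
... | no  t≰d = ⊥-elim (t≰d t≤d)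

shift-≰ : ∀ {t d} g → ¬ t ≤ d → shift t g d ≡ 0ℤ
shift-≰ {t} {d} g t≰d with t ≤? d
... | yes t≤d = ⊥-elim (t≰d t≤d)
... | no  _   = refl

shift-cong : ∀ t {g g′} → g ≗ g′ → shift t g ≗ shift t g′
shift-cong t g≗g′ d with t ≤? d
... | yes _ = g≗g′ (d ∸ t)
... | no  _ = refl

shift-nonneg : ∀ t {g} → Nonneg g → Nonneg (shift t g)
shift-nonneg t g≥0 d with t ≤? d
... | yes _ = g≥0 (d ∸ t)
... | no  _ = +≤+ z≤n

shift-z^ : ∀ ℓ t → shift ℓ (z^ t) ≗ z^ (ℓ + t)
shift-z^ ℓ t k with ℓ ≤? k
... | no ℓ≰k = sym (z^-off λ k≡ → ℓ≰k (subst (ℓ ≤_) (sym k≡) (m≤m+n ℓ t)))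
... | yes ℓ≤k with k ≟ ℓ + t
...   | yes refl = trans (cong (z^ t) (m+n∸m≡n ℓ t)) (trans (z^-diag t) (sym (z^-diag (ℓ + t))))
...   | no k≢ = trans
  (z^-off λ k∸ℓ≡t → k≢ (trans (sym (m∸n+n≡m ℓ≤k)) (trans (cong (_+ ℓ) k∸ℓ≡t) (+-comm t ℓ))))
  (sym (z^-off k≢))

shift-+ : ∀ ℓ t g d → ℓ ≤ d → shift (ℓ + t) g d ≡ shift t g (d ∸ ℓ)
shift-+ ℓ t g d ℓ≤d with ℓ + t ≤? d | t ≤? d ∸ ℓ
... | yes _     | yes _  = cong g (sym (∸-+-assoc d ℓ t))
... | yes ℓ+t≤d | no t≰  = ⊥-elim (t≰ (subst (_≤ d ∸ ℓ) (m+n∸m≡n ℓ t) (∸-monoˡ-≤ ℓ ℓ+t≤d)))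
... | no ℓ+t≰   | yes t≤ = ⊥-elim (ℓ+t≰ (subst (ℓ + t ≤_) (m+[n∸m]≡n ℓ≤d) (+-monoʳ-≤ ℓ t≤)))
... | no _      | no _   = refl

⋆-congˡ : ∀ {f f′} g → f ≗ f′ → (f ⋆ g) ≗ (f′ ⋆ g)
⋆-congˡ g f≗f′ d = Σ≤-cong d (λ k _ → cong (ℤ._* g (d ∸ k)) (f≗f′ k))

⋆-congʳ : ∀ f {g g′} → g ≗ g′ → (f ⋆ g) ≗ (f ⋆ g′)
⋆-congʳ f g≗g′ d = Σ≤-cong d (λ k _ → cong (f k ℤ.*_) (g≗g′ (d ∸ k)))

z^-⋆ : ∀ t g → (z^ t ⋆ g) ≗ shift t g
z^-⋆ t g d with t ≤? d
... | yes t≤d = trans (Σ≤-single d t t≤d λ k _ k≢t → cong (ℤ._* g (d ∸ k)) (z^-off k≢t))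
                      (trans (cong (ℤ._* g (d ∸ t)) (z^-diag t)) (ℤ.*-identityˡ _))
... | no  t≰d = Σ≤-≡0 d λ k k≤d →
  cong (ℤ._* g (d ∸ k)) (z^-off λ k≡t → t≰d (subst (_≤ d) k≡t k≤d))

⋆-z^ : ∀ t g → (g ⋆ z^ t) ≗ shift t g
⋆-z^ t g d with t ≤? d
... | yes t≤d = trans (Σ≤-single d (d ∸ t) (m∸n≤m d t) others)
                      (trans (cong (g (d ∸ t) ℤ.*_) (trans (cong (z^ t) (m∸[m∸n]≡n t≤d)) (z^-diag t)))
                             (ℤ.*-identityʳ _))
  where
  others : ∀ k → k ≤ d → k ≢ d ∸ t → g k ℤ.* (z^ t) (d ∸ k) ≡ 0ℤ
  others k k≤d k≢ = trans (cong (g k ℤ.*_) (z^-off {t} {d ∸ k} λ d∸k≡t →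
                                              k≢ (trans (sym (m∸[m∸n]≡n k≤d)) (cong (d ∸_) d∸k≡t))))
                          (ℤ.*-zeroʳ (g k))
... | no  t≰d = Σ≤-≡0 d λ k _ →
  trans (cong (g k ℤ.*_) (z^-off λ d∸k≡t → t≰d (subst (_≤ d) d∸k≡t (m∸n≤m d k)))) (ℤ.*-zeroʳ (g k))

⋆-nonneg : ∀ {f g} → Nonneg f → Nonneg g → Nonneg (f ⋆ g)
⋆-nonneg f≥0 g≥0 d = Σ≤-nonneg (λ k → *-nonneg (f≥0 k) (g≥0 (d ∸ k))) d

term≤⋆ : ∀ {f g} → Nonneg f → Nonneg g → ∀ {k d} → k ≤ d
  → f k ℤ.* g (d ∸ k) ℤ.≤ (f ⋆ g) d
term≤⋆ f≥0 g≥0 {d = d} = term≤Σ≤ (λ k → *-nonneg (f≥0 k) (g≥0 (d ∸ k)))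

^ˢ-nonneg : ∀ {f} → Nonneg f → ∀ j → Nonneg (f ^ˢ j)
^ˢ-nonneg f≥0 zero    = z^-nonneg 0
^ˢ-nonneg f≥0 (suc j) = ⋆-nonneg f≥0 (^ˢ-nonneg f≥0 j)

^ˢ-z^ : ∀ {f} ℓ → f ≗ z^ ℓ → ∀ j → f ^ˢ j ≗ z^ (j * ℓ)
^ˢ-z^ ℓ f≗z^ℓ zero    k = refl
^ˢ-z^ {f} ℓ f≗z^ℓ (suc j) k = begin
  (f ⋆ (f ^ˢ j)) k         ≡⟨ ⋆-congˡ (f ^ˢ j) f≗z^ℓ k ⟩
  (z^ ℓ ⋆ (f ^ˢ j)) k      ≡⟨ z^-⋆ ℓ (f ^ˢ j) k ⟩
  shift ℓ (f ^ˢ j) k       ≡⟨ shift-cong ℓ (^ˢ-z^ ℓ f≗z^ℓ j) k ⟩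
  shift ℓ (z^ (j * ℓ)) k   ≡⟨ shift-z^ ℓ (j * ℓ) k ⟩
  (z^ (ℓ + j * ℓ)) k       ∎
  where open ≡-Reasoning

oneMinusZ^-⋆ : ∀ ℓ g → (oneMinusZ^ ℓ ⋆ g) ≗ (λ d → g d ℤ.- shift ℓ g d)
oneMinusZ^-⋆ ℓ g d = begin
  (oneMinusZ^ ℓ ⋆ g) d
    ≡⟨ Σ≤-cong d (λ k _ → distrib ((z^ 0) k) ((z^ ℓ) k) (g (d ∸ k))) ⟩
  Σ≤ (λ k → (z^ 0) k ℤ.* g (d ∸ k) ℤ.- (z^ ℓ) k ℤ.* g (d ∸ k)) d
    ≡⟨ Σ≤-distrib-- _ _ d ⟩
  (z^ 0 ⋆ g) d ℤ.- (z^ ℓ ⋆ g) d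
    ≡⟨ cong₂ ℤ._-_ (z^-⋆ 0 g d) (z^-⋆ ℓ g d) ⟩
  shift 0 g d ℤ.- shift ℓ g d
    ≡⟨ cong (ℤ._- shift ℓ g d) (shift-≤ g z≤n) ⟩
  g d ℤ.- shift ℓ g d
    ∎
  where
  open ≡-Reasoning
  distrib : ∀ a b c → (a ℤ.- b) ℤ.* c ≡ a ℤ.* c ℤ.- b ℤ.* c
  distrib = solve-∀

oneMinusZ^-nonneg⇔ : ∀ ℓ (f : ℕ → ℕ) → f 0 ≡ 0
  → Nonneg (oneMinusZ^ ℓ ⋆ (+_ ∘ f)) ⇔ (∀ d → 1 ≤ d → f d ≤ f (d + ℓ))
oneMinusZ^-nonneg⇔ ℓ f f0≡0 = mk⇔ to from
  where
  to : Nonneg (oneMinusZ^ ℓ ⋆ (+_ ∘ f)) → ∀ d → 1 ≤ d → f d ≤ f (d + ℓ)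
  to nonneg d _ = ℤ.drop‿+≤+ (ℤ.0≤i-j⇒j≤i (subst (0ℤ ℤ.≤_) coeff (nonneg (d + ℓ))))
    where
    coeff : (oneMinusZ^ ℓ ⋆ (+_ ∘ f)) (d + ℓ) ≡ + f (d + ℓ) ℤ.- + f d
    coeff = trans (oneMinusZ^-⋆ ℓ (+_ ∘ f) (d + ℓ)) (cong (λ y → + f (d + ℓ) ℤ.- y)
                  (trans (shift-≤ (+_ ∘ f) (m≤n+m ℓ d)) (cong (+_ ∘ f) (m+n∸n≡m d ℓ))))
  from : (∀ d → 1 ≤ d → f d ≤ f (d + ℓ)) → Nonneg (oneMinusZ^ ℓ ⋆ (+_ ∘ f))
  from mono d = subst (0ℤ ℤ.≤_) (sym (oneMinusZ^-⋆ ℓ (+_ ∘ f) d)) (by-cases (ℓ ≤? d))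
    where
    by-cases : Dec (ℓ ≤ d) → 0ℤ ℤ.≤ + f d ℤ.- shift ℓ (+_ ∘ f) d
    by-cases (no ℓ≰d) =
      subst (λ y → 0ℤ ℤ.≤ + f d ℤ.- y) (sym (shift-≰ (+_ ∘ f) ℓ≰d)) (ℤ.i≤j⇒0≤j-i (+≤+ z≤n))
    by-cases (yes ℓ≤d) =
      subst (λ y → 0ℤ ℤ.≤ + f d ℤ.- y) (sym (shift-≤ (+_ ∘ f) ℓ≤d)) (ℤ.i≤j⇒0≤j-i (+≤+ earlier≤))
      where
      earlier≤ : f (d ∸ ℓ) ≤ f d
      earlier≤ with d ∸ ℓ ≟ 0
      ... | yes d∸ℓ≡0 = subst (_≤ f d) (sym (trans (cong f d∸ℓ≡0) f0≡0)) z≤n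
      ... | no  d∸ℓ≢0 =
        subst (λ e → f (d ∸ ℓ) ≤ f e) (m∸n+n≡m ℓ≤d) (mono (d ∸ ℓ) (n≢0⇒n>0 d∸ℓ≢0))

-- g / (1 - z^ℓ) = Σ_j z^(jℓ) g; for ℓ ≥ 1 only the terms j ≤ d reach degree d
divOneMinusZ^ : ℕ → Series → Series
divOneMinusZ^ ℓ g d = Σ≤ (λ j → shift (j * ℓ) g d) d

divOneMinusZ^-cong : ∀ ℓ {g g′} → g ≗ g′ → divOneMinusZ^ ℓ g ≗ divOneMinusZ^ ℓ g′
divOneMinusZ^-cong ℓ g≗g′ d = Σ≤-cong d (λ j _ → shift-cong (j * ℓ) g≗g′ d)

divOneMinusZ^-unfold : ∀ {ℓ} → 1 ≤ ℓ → ∀ g d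
  → divOneMinusZ^ ℓ g d ≡ g d ℤ.+ shift ℓ (divOneMinusZ^ ℓ g) d
divOneMinusZ^-unfold {ℓ} 1≤ℓ g zero = trans (shift-≤ g z≤n)
  (trans (sym (ℤ.+-identityʳ (g 0))) (cong (λ y → g 0 ℤ.+ y) (sym (shift-≰ _ (<⇒≱ 1≤ℓ)))))
divOneMinusZ^-unfold {ℓ} 1≤ℓ g (suc d) =
  trans (Σ≤-head (λ j → shift (j * ℓ) g (suc d)) d) (cong₂ ℤ._+_ (shift-≤ g z≤n) shifted)
  where
  shifted : Σ≤ (λ j → shift (ℓ + j * ℓ) g (suc d)) d ≡ shift ℓ (divOneMinusZ^ ℓ g) (suc d)
  shifted with ℓ ≤? suc d
  ... | yes ℓ≤ = trans (Σ≤-cong d (λ j _ → shift-+ ℓ (j * ℓ) g (suc d) ℓ≤))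
                       (Σ≤-truncate (suc d ∸ ℓ) d (∸-monoʳ-≤ (suc d) 1≤ℓ)
                          λ j j> _ → shift-≰ g λ j*ℓ≤ →
                            <⇒≱ j> (≤-trans (m≤m*n j ℓ {{>-nonZero 1≤ℓ}}) j*ℓ≤))
  ... | no ℓ≰ = Σ≤-≡0 d λ j _ → shift-≰ g λ ℓ+j*ℓ≤ → ℓ≰ (≤-trans (m≤m+n ℓ (j * ℓ)) ℓ+j*ℓ≤)

divOneMinusZ^-⇔ : ∀ {ℓ} → 1 ≤ ℓ → ∀ g h → (divOneMinusZ^ ℓ g ≗ h) ⇔ (oneMinusZ^ ℓ ⋆ h ≗ g)
divOneMinusZ^-⇔ {ℓ} 1≤ℓ g h = mk⇔ to from
  where
  to : divOneMinusZ^ ℓ g ≗ h → oneMinusZ^ ℓ ⋆ h ≗ g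
  to quot≗h d = trans (oneMinusZ^-⋆ ℓ h d) (cancel (g d) (shift ℓ h d) (h d) (begin
    h d                                    ≡⟨ sym (quot≗h d) ⟩
    divOneMinusZ^ ℓ g d                    ≡⟨ divOneMinusZ^-unfold 1≤ℓ g d ⟩
    g d ℤ.+ shift ℓ (divOneMinusZ^ ℓ g) d  ≡⟨ cong (λ y → g d ℤ.+ y) (shift-cong ℓ quot≗h d) ⟩
    g d ℤ.+ shift ℓ h d                    ∎))
    where
    open ≡-Reasoning
    cancel : ∀ a b c → c ≡ a ℤ.+ b → c ℤ.- b ≡ a
    cancel a b .(a ℤ.+ b) refl = i+j-j≡i a b
  from : oneMinusZ^ ℓ ⋆ h ≗ g → divOneMinusZ^ ℓ g ≗ h
  from prod≗g = <-rec (λ d → divOneMinusZ^ ℓ g d ≡ h d) step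
    where
    step : ∀ d → (∀ {d′} → d′ < d → divOneMinusZ^ ℓ g d′ ≡ h d′) → divOneMinusZ^ ℓ g d ≡ h d
    step d below = begin
      divOneMinusZ^ ℓ g d                    ≡⟨ divOneMinusZ^-unfold 1≤ℓ g d ⟩
      g d ℤ.+ shift ℓ (divOneMinusZ^ ℓ g) d  ≡⟨ cong (λ y → g d ℤ.+ y) shift≡ ⟩
      g d ℤ.+ shift ℓ h d                    ≡⟨ cong (ℤ._+ shift ℓ h d) g≡h-zh ⟩
      h d ℤ.- shift ℓ h d ℤ.+ shift ℓ h d    ≡⟨ i-j+j≡i (h d) (shift ℓ h d) ⟩
      h d                                    ∎
      where
      open ≡-Reasoning
      g≡h-zh : g d ≡ h d ℤ.- shift ℓ h d
      g≡h-zh = trans (sym (prod≗g d)) (oneMinusZ^-⋆ ℓ h d)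
      shift≡ : shift ℓ (divOneMinusZ^ ℓ g) d ≡ shift ℓ h d
      shift≡ with ℓ ≤? d
      ... | yes ℓ≤d = below (∸-monoʳ-< {d} {ℓ} {0} 1≤ℓ ℓ≤d)
      ... | no  _   = refl

-- Integers spelled by bit strings

IsBit : ℤ → Set
IsBit b = b ≡ 0ℤ ⊎ b ≡ + 1

0≤b≤1⇒IsBit : ∀ {b} → 0ℤ ℤ.≤ b → b ℤ.≤ + 1 → IsBit b
0≤b≤1⇒IsBit {+ zero}          _ _ = inj₁ refl
0≤b≤1⇒IsBit {+ suc zero}      _ _ = inj₂ refl
0≤b≤1⇒IsBit {+ suc (suc _)}   _ (+≤+ (s≤s ()))

2*+-cancelʳ : ∀ z v b → + 2 ℤ.* z ℤ.+ b ≡ + 2 ℤ.* v ℤ.+ b → z ≡ v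
2*+-cancelʳ z v b eq =
  ℤ.*-cancelˡ-≡ (+ 2) z v (trans (sym (i+j-j≡i _ b)) (trans (cong (ℤ._- b) eq) (i+j-j≡i _ b)))

2*≢2*+1 : ∀ z v → + 2 ℤ.* z ℤ.+ 0ℤ ≢ + 2 ℤ.* v ℤ.+ + 1
2*≢2*+1 z v eq =
  2≢1 (m*n≡1⇒m≡1 2 ℤ.∣ z ℤ.- v ∣ (trans (sym (ℤ.abs-* (+ 2) (z ℤ.- v))) (cong ℤ.∣_∣ 2[z-v]≡1)))
  where
  open ≡-Reasoning
  2≢1 : 2 ≢ 1
  2≢1 ()
  2[z-v]≡1 : + 2 ℤ.* (z ℤ.- v) ≡ + 1
  2[z-v]≡1 = begin
    + 2 ℤ.* (z ℤ.- v)                    ≡⟨ expand z v ⟩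
    (+ 2 ℤ.* z ℤ.+ 0ℤ) ℤ.- + 2 ℤ.* v     ≡⟨ cong (ℤ._- + 2 ℤ.* v) eq ⟩
    (+ 2 ℤ.* v ℤ.+ + 1) ℤ.- + 2 ℤ.* v    ≡⟨ cancel v ⟩
    + 1                                  ∎
    where
    expand : ∀ z v → + 2 ℤ.* (z ℤ.- v) ≡ (+ 2 ℤ.* z ℤ.+ 0ℤ) ℤ.- + 2 ℤ.* v
    expand = solve-∀
    cancel : ∀ v → (+ 2 ℤ.* v ℤ.+ + 1) ℤ.- + 2 ℤ.* v ≡ + 1
    cancel = solve-∀

2*+bit-injective : ∀ z v {b c} → IsBit b → IsBit c
  → + 2 ℤ.* z ℤ.+ b ≡ + 2 ℤ.* v ℤ.+ c → z ≡ v × b ≡ c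
2*+bit-injective z v (inj₁ refl) (inj₁ refl) eq = 2*+-cancelʳ z v 0ℤ eq , refl
2*+bit-injective z v (inj₂ refl) (inj₂ refl) eq = 2*+-cancelʳ z v (+ 1) eq , refl
2*+bit-injective z v (inj₁ refl) (inj₂ refl) eq = ⊥-elim (2*≢2*+1 z v eq)
2*+bit-injective z v (inj₂ refl) (inj₁ refl) eq = ⊥-elim (2*≢2*+1 v z (sym eq))

-- w D is the integer with binary digits e 0 … e D, i.e. Σ_{k ≤ D} 2^(D ∸ k) e k
Accumulates : Series → Series → Set
Accumulates e w = w 0 ≡ e 0 × (∀ D → w (suc D) ≡ + 2 ℤ.* w D ℤ.+ e (suc D))

shift-accumulates : ∀ t {e w} → Accumulates e w → Accumulates (shift t e) (shift t w)
shift-accumulates t {e} {w} (w0 , wS) = start , step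
  where
  open ≡-Reasoning
  start : shift t w 0 ≡ shift t e 0
  start with t ≤? 0
  ... | yes _ = trans (cong w (0∸n≡0 t)) (trans w0 (cong e (sym (0∸n≡0 t))))
  ... | no  _ = refl
  step : ∀ D → shift t w (suc D) ≡ + 2 ℤ.* shift t w D ℤ.+ shift t e (suc D)
  step D = by-cases (t ≤? D) (t ≟ suc D)
    where
    by-cases : Dec (t ≤ D) → Dec (t ≡ suc D)
      → shift t w (suc D) ≡ + 2 ℤ.* shift t w D ℤ.+ shift t e (suc D)
    by-cases (yes t≤D) _ = begin
      shift t w (suc D)                            ≡⟨ shift-≤ w (m≤n⇒m≤1+n t≤D) ⟩
      w (suc D ∸ t)                                ≡⟨ cong w suc∸ ⟩
      w (suc (D ∸ t))                              ≡⟨ wS (D ∸ t) ⟩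
      + 2 ℤ.* w (D ∸ t) ℤ.+ e (suc (D ∸ t))
        ≡⟨ cong₂ (λ y y′ → + 2 ℤ.* y ℤ.+ y′) (sym (shift-≤ w t≤D))
                 (trans (cong e (sym suc∸)) (sym (shift-≤ e (m≤n⇒m≤1+n t≤D)))) ⟩
      + 2 ℤ.* shift t w D ℤ.+ shift t e (suc D)    ∎
      where
      suc∸ : suc D ∸ t ≡ suc (D ∸ t)
      suc∸ = +-∸-assoc 1 t≤D
    by-cases (no t≰D) (yes refl) = begin
      shift (suc D) w (suc D)                      ≡⟨ shift-≤ {suc D} {suc D} w ≤-refl ⟩
      w (suc D ∸ suc D)                            ≡⟨ cong w (n∸n≡0 (suc D)) ⟩
      w 0                                          ≡⟨ w0 ⟩
      e 0                                          ≡⟨ cong e (sym (n∸n≡0 (suc D))) ⟩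
      e (suc D ∸ suc D)                            ≡⟨ sym (shift-≤ {suc D} {suc D} e ≤-refl) ⟩
      shift (suc D) e (suc D)                      ≡⟨ sym (ℤ.+-identityˡ _) ⟩
      0ℤ ℤ.+ shift (suc D) e (suc D)
        ≡⟨ cong (λ y → + 2 ℤ.* y ℤ.+ shift (suc D) e (suc D)) (sym (shift-≰ w t≰D)) ⟩
      + 2 ℤ.* shift (suc D) w D ℤ.+ shift (suc D) e (suc D) ∎
    by-cases (no t≰D) (no t≢) = trans (shift-≰ w t≰sD)
      (cong₂ (λ y y′ → + 2 ℤ.* y ℤ.+ y′) (sym (shift-≰ w t≰D)) (sym (shift-≰ e t≰sD)))
      where
      t≰sD : ¬ t ≤ suc D
      t≰sD t≤sD = t≰D (s≤s⁻¹ (≤∧≢⇒< t≤sD t≢))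

-‿accumulates : ∀ {e e′ w w′} → Accumulates e w → Accumulates e′ w′
  → Accumulates (λ d → e d ℤ.- e′ d) (λ d → w d ℤ.- w′ d)
-‿accumulates {e} {e′} {w} {w′} (w0 , wS) (w′0 , w′S) =
  cong₂ ℤ._-_ w0 w′0 ,
  λ D → trans (cong₂ ℤ._-_ (wS D) (w′S D)) (regroup (w D) (w′ D) (e (suc D)) (e′ (suc D)))
  where
  regroup : ∀ a b c d → (+ 2 ℤ.* a ℤ.+ c) ℤ.- (+ 2 ℤ.* b ℤ.+ d) ≡ + 2 ℤ.* (a ℤ.- b) ℤ.+ (c ℤ.- d)
  regroup = solve-∀

accumulates-unique : ∀ {e e′ w w′} L → Accumulates e w → Accumulates e′ w′
  → (∀ d → IsBit (e d)) → (∀ d → IsBit (e′ d))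
  → (∀ t → w (L + t) ≡ w′ (L + t)) → e ≗ e′
accumulates-unique {e} {e′} {w} {w′} L (w0 , wS) (w′0 , w′S) e-bit e′-bit agree = e≗e′
  where
  peel : ∀ D → w (suc D) ≡ w′ (suc D) → w D ≡ w′ D × e (suc D) ≡ e′ (suc D)
  peel D eq = 2*+bit-injective (w D) (w′ D) (e-bit (suc D)) (e′-bit (suc D))
                                (trans (sym (wS D)) (trans eq (w′S D)))
  descend : ∀ t D → w (t + D) ≡ w′ (t + D) → w D ≡ w′ D
  descend zero    D eq = eq
  descend (suc t) D eq = descend t D (proj₁ (peel (t + D) eq))
  w≗w′ : w ≗ w′
  w≗w′ D = descend L D (agree D)
  e≗e′ : e ≗ e′
  e≗e′ zero    = trans (sym w0) (trans (w≗w′ 0) w′0)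
  e≗e′ (suc D) = proj₂ (peel D (w≗w′ (suc D)))

-- Binary digits of fractions

[k*n+m]/n≡k+m/n : ∀ k m n .{{_ : NonZero n}} → (k * n + m) / n ≡ k + m / n
[k*n+m]/n≡k+m/n k m n = trans (+-distrib-/-∣ˡ m (n∣m*n k)) (cong (_+ m / n) (m*n/n≡m k n))

[2*m]/n≡2*[m/n]+[2*m]/n%2 : ∀ m n .{{_ : NonZero n}} → 2 * m / n ≡ 2 * (m / n) + (2 * m / n) % 2
[2*m]/n≡2*[m/n]+[2*m]/n%2 m n = begin
  q                      ≡⟨ m≡m%n+[m/n]*n q 2 ⟩
  q % 2 + q / 2 * 2      ≡⟨ cong (λ y → q % 2 + y * 2) q/2≡m/n ⟩
  q % 2 + m / n * 2      ≡⟨ +-comm (q % 2) (m / n * 2) ⟩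
  m / n * 2 + q % 2      ≡⟨ cong (_+ q % 2) (*-comm (m / n) 2) ⟩
  2 * (m / n) + q % 2    ∎
  where
  open ≡-Reasoning
  q : ℕ
  q = 2 * m / n
  instance _ : NonZero (n * 2)
  _ = m*n≢0 n 2
  q/2≡m/n : q / 2 ≡ m / n
  q/2≡m/n = trans (m/n/o≡m/[n*o] (2 * m) n 2)
                  (trans (cong (_/ (n * 2)) (*-comm 2 m)) (m*n/o*n≡m/o m 2 n))

ε-nonZero : ∀ d A B .{{_ : NonZero B}} → ε d A B ≡ (2 ^ d * A / B) % 2
ε-nonZero d A (suc B) = refl

cK-nonZero : ∀ K m .{{_ : NonZero m}} → cK K m ≡ 2 ^ K / m
cK-nonZero K (suc m) = refl

ε≤1 : ∀ d A B → ε d A B ≤ 1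
ε≤1 d A zero    = z≤n
ε≤1 d A (suc B) = s≤s⁻¹ (m%n<n (2 ^ d * A / suc B) 2)

ε≡1 : ∀ {d A B} .{{_ : NonZero B}} → 2 ^ d * A / B ≡ 1 → ε d A B ≡ 1
ε≡1 {d} {A} {B} q≡1 = trans (ε-nonZero d A B) (cong (_% 2) q≡1)

ε0≡0 : ∀ {A B} .{{_ : NonZero B}} → A < B → ε 0 A B ≡ 0
ε0≡0 {A} {B} A<B =
  trans (ε-nonZero 0 A B) (cong (_% 2) (m<n⇒m/n≡0 (subst (_< B) (sym (*-identityˡ A)) A<B)))

digits-isBit : ∀ A B d → IsBit (digits A B d)
digits-isBit A B d with ε d A B | ε≤1 d A B
... | zero        | _ = inj₁ refl
... | suc zero    | _ = inj₂ refl
... | suc (suc _) | s≤s ()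

digits-nonneg : ∀ A B → Nonneg (digits A B)
digits-nonneg A B d = +≤+ z≤n

prefixValue : ∀ A B .{{_ : NonZero B}} → Series
prefixValue A B D = + (2 ^ D * A / B)

prefixValue-accumulates : ∀ {A B} .{{_ : NonZero B}} → A < B
  → Accumulates (digits A B) (prefixValue A B)
prefixValue-accumulates {A} {B} A<B = cong +_ (trans A/B≡0 (sym (ε0≡0 A<B))) , step
  where
  open ≡-Reasoning
  A/B≡0 : 1 * A / B ≡ 0
  A/B≡0 = m<n⇒m/n≡0 (subst (_< B) (sym (*-identityˡ A)) A<B)
  step : ∀ D → prefixValue A B (suc D) ≡ + 2 ℤ.* prefixValue A B D ℤ.+ digits A B (suc D)
  step D = begin
    + (2 ^ suc D * A / B)
      ≡⟨ cong (λ y → + (y / B)) (*-assoc 2 (2 ^ D) A) ⟩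
    + (2 * (2 ^ D * A) / B)
      ≡⟨ cong +_ ([2*m]/n≡2*[m/n]+[2*m]/n%2 (2 ^ D * A) B) ⟩
    + (2 * (2 ^ D * A / B) + (2 * (2 ^ D * A) / B) % 2)
      ≡⟨ ℤ.pos-+ (2 * (2 ^ D * A / B)) _ ⟩
    + (2 * (2 ^ D * A / B)) ℤ.+ + ((2 * (2 ^ D * A) / B) % 2)
      ≡⟨ cong₂ ℤ._+_ (ℤ.pos-* 2 (2 ^ D * A / B)) (cong (λ y → + ((y / B) % 2)) (sym (*-assoc 2 (2 ^ D) A))) ⟩
    + 2 ℤ.* prefixValue A B D ℤ.+ + ((2 ^ suc D * A / B) % 2)
      ≡⟨ cong (λ y → + 2 ℤ.* prefixValue A B D ℤ.+ + y) (sym (ε-nonZero (suc D) A B)) ⟩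
    + 2 ℤ.* prefixValue A B D ℤ.+ digits A B (suc D)
      ∎

first-one-digit : ∀ {A B} .{{_ : NonZero B}} → 0 < A → A < B
  → ∃[ d ] (1 ≤ d × 2 ^ d * A / B ≡ 1)
first-one-digit {A} {B} 0<A A<B = search (B ∸ A) A 0<A A<B ≤-refl
  where
  B≤m<2B⇒m/B≡1 : ∀ {m} → B ≤ m → m < 2 * B → m / B ≡ 1
  B≤m<2B⇒m/B≡1 {m} B≤m m<2B = trans (m/n≡1+[m∸n]/n B≤m) (cong suc (m<n⇒m/n≡0 m∸B<B))
    where
    m∸B<B : m ∸ B < B
    m∸B<B = +-cancelˡ-< B (m ∸ B) B
      (subst (_< B + B) (sym (m+[n∸m]≡n B≤m)) (subst (m <_) (cong (_+_ B) (+-identityʳ B)) m<2B))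
  swap : ∀ p A → (2 * p) * A ≡ p * (2 * A)
  swap p A = trans (cong (_* A) (*-comm 2 p)) (*-assoc p 2 A)
  search : ∀ f A → 0 < A → A < B → B ∸ A ≤ f → ∃[ d ] (1 ≤ d × 2 ^ d * A / B ≡ 1)
  search zero    A _   A<B B∸A≤0 = ⊥-elim (<⇒≢ (m<n⇒0<n∸m A<B) (sym (n≤0⇒n≡0 B∸A≤0)))
  search (suc f) A 0<A A<B B∸A≤ with B ≤? 2 * A
  ... | yes B≤2A = 1 , ≤-refl , B≤m<2B⇒m/B≡1 B≤2A (*-monoʳ-< 2 A<B)
  ... | no B≰2A with search f (2 * A) (≤-trans 0<A (m≤n*m A 2)) (≰⇒> B≰2A) (s≤s⁻¹ (<-≤-trans B∸2A<B∸A B∸A≤))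
    where
    B∸2A<B∸A : B ∸ 2 * A < B ∸ A
    B∸2A<B∸A = ∸-monoʳ-< (subst (A <_) (*-comm A 2) (m<m*n A 2 {{>-nonZero 0<A}} ≤-refl)) (<⇒≤ (≰⇒> B≰2A))
  ...   | d , _ , q≡1 = suc d , s≤s z≤n , trans (cong (_/ B) (swap (2 ^ d) A)) q≡1

2^k*2^u≡2^[u+k] : ∀ k u → 2 ^ k * 2 ^ u ≡ 2 ^ (u + k)
2^k*2^u≡2^[u+k] k u = trans (sym (^-distribˡ-+-* 2 k u)) (cong (2 ^_) (+-comm k u))

digits-2^ : ∀ u ℓ → digits (2 ^ u) (2 ^ (u + ℓ)) ≗ z^ ℓ
digits-2^ u ℓ k = trans (cong +_ (ε-nonZero k (2 ^ u) B)) (by-cases (<-cmp k ℓ))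
  where
  B : ℕ
  B = 2 ^ (u + ℓ)
  instance _ : NonZero B
  _ = m^n≢0 2 (u + ℓ)
  q : ℕ
  q = 2 ^ k * 2 ^ u / B
  by-cases : Tri (k < ℓ) (k ≡ ℓ) (ℓ < k) → + (q % 2) ≡ (z^ ℓ) k
  by-cases (tri< k<ℓ _ _) =
    trans (cong (λ y → + (y % 2)) (m<n⇒m/n≡0 2^k*2^u<B)) (sym (z^-off (<⇒≢ k<ℓ)))
    where
    2^k*2^u<B : 2 ^ k * 2 ^ u < B
    2^k*2^u<B = subst (_< B) (sym (2^k*2^u≡2^[u+k] k u)) (^-monoʳ-< 2 ≤-refl (+-monoʳ-< u k<ℓ))
  by-cases (tri≈ _ refl _) = trans (cong (λ y → + ((y / B) % 2)) (2^k*2^u≡2^[u+k] k u))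
                                   (trans (cong (λ y → + (y % 2)) (n/n≡1 B)) (sym (z^-diag k)))
  by-cases (tri> _ _ ℓ<k) = trans (cong (λ y → + (y % 2)) q≡2*2^t)
                                  (trans (cong +_ 2*2^t%2≡0) (sym (z^-off (<⇒≢ ℓ<k ∘ sym))))
    where
    t : ℕ
    t = k ∸ suc ℓ
    u+k≡ : u + k ≡ suc t + (u + ℓ)
    u+k≡ = begin
      u + k                ≡⟨ cong (_+_ u) (sym (m∸n+n≡m ℓ<k)) ⟩
      u + (t + suc ℓ)      ≡⟨ solve-ℕ u t ℓ ⟩
      suc t + (u + ℓ)      ∎
      where
      open ≡-Reasoning
      solve-ℕ : ∀ u t ℓ → u + (t + suc ℓ) ≡ suc t + (u + ℓ)
      solve-ℕ = ℕ-solve-∀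
    q≡2*2^t : q ≡ 2 * 2 ^ t
    q≡2*2^t = trans (cong (_/ B) (trans (2^k*2^u≡2^[u+k] k u)
                                        (trans (cong (2 ^_) u+k≡) (^-distribˡ-+-* 2 (suc t) (u + ℓ)))))
                    (m*n/n≡m (2 * 2 ^ t) B)
    2*2^t%2≡0 : (2 * 2 ^ t) % 2 ≡ 0
    2*2^t%2≡0 = trans (cong (_% 2) (*-comm 2 (2 ^ t))) (m*n%n≡0 (2 ^ t) 2)

single-one-digit⇒dyadic : ∀ {A B} .{{_ : NonZero B}} → 0 < A → A < B
  → (∀ s t → 1 ≤ s → 1 ≤ t → ε s A B ≡ 1 → ε t A B ≡ 1 → s ≡ t)
  → ∃[ s ] (1 ≤ s × 2 ^ s * A ≡ B)
single-one-digit⇒dyadic {A} {B} 0<A A<B single with first-one-digit 0<A A<B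
... | s , 1≤s , q≡1 with (2 ^ s * A) % B ≟ 0
...   | yes r≡0 = s , 1≤s , (begin
  2 ^ s * A                           ≡⟨ m≡m%n+[m/n]*n (2 ^ s * A) B ⟩
  (2 ^ s * A) % B + 2 ^ s * A / B * B ≡⟨ cong₂ (λ r y → r + y * B) r≡0 q≡1 ⟩
  1 * B                               ≡⟨ *-identityˡ B ⟩
  B                                   ∎)
  where open ≡-Reasoning
-- a nonzero remainder r = 2^s A - B yields a second 1-digit of A/B, at position s plus that of r/B
...   | no r≢0 with first-one-digit (n≢0⇒n>0 r≢0) (m%n<n (2 ^ s * A) B)
...     | t , 1≤t , q′≡1 =
  ⊥-elim (<⇒≢ 1≤t (sym (+-cancelˡ-≡ s t 0 (trans s+t≡s (sym (+-identityʳ s))))))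
  where
  open ≡-Reasoning
  r : ℕ
  r = (2 ^ s * A) % B
  swap : ∀ a b c → a * b * c ≡ b * (a * c)
  swap = ℕ-solve-∀
  quotient : 2 ^ (s + t) * A / B ≡ 1 + 2 ^ t
  quotient = begin
    2 ^ (s + t) * A / B                       ≡⟨ cong (λ y → y * A / B) (^-distribˡ-+-* 2 s t) ⟩
    2 ^ s * 2 ^ t * A / B                     ≡⟨ cong (_/ B) (swap (2 ^ s) (2 ^ t) A) ⟩
    2 ^ t * (2 ^ s * A) / B                   ≡⟨ cong (λ y → 2 ^ t * y / B) (m≡m%n+[m/n]*n (2 ^ s * A) B) ⟩
    2 ^ t * (r + 2 ^ s * A / B * B) / B       ≡⟨ cong (λ y → 2 ^ t * (r + y * B) / B) q≡1 ⟩
    2 ^ t * (r + 1 * B) / B                   ≡⟨ cong (_/ B) (*-distribˡ-+ (2 ^ t) r (1 * B)) ⟩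
    (2 ^ t * r + 2 ^ t * (1 * B)) / B         ≡⟨ cong (λ y → (2 ^ t * r + 2 ^ t * y) / B) (*-identityˡ B) ⟩
    (2 ^ t * r + 2 ^ t * B) / B               ≡⟨ +-distrib-/-∣ʳ (2 ^ t * r) (n∣m*n (2 ^ t)) ⟩
    2 ^ t * r / B + 2 ^ t * B / B             ≡⟨ cong₂ _+_ q′≡1 (m*n/n≡m (2 ^ t) B) ⟩
    1 + 2 ^ t                                 ∎
  1+2^-odd : ∀ t → 1 ≤ t → (1 + 2 ^ t) % 2 ≡ 1
  1+2^-odd (suc t′) _ = trans (cong (λ y → (1 + y) % 2) (*-comm 2 (2 ^ t′))) ([m+kn]%n≡m%n 1 (2 ^ t′) 2)
  s+t≡s : s + t ≡ s
  s+t≡s = single (s + t) s (≤-trans 1≤s (m≤m+n s t)) 1≤s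
            (trans (ε-nonZero (s + t) A B) (trans (cong (_% 2) quotient) (1+2^-odd t 1≤t))) (ε≡1 q≡1)

-- Powers of two, odd numbers and finite sums of weights

n≤2^⌈log₂n⌉ : ∀ n → n ≤ 2 ^ ⌈log₂ n ⌉
n≤2^⌈log₂n⌉ = <-rec (λ n → n ≤ 2 ^ ⌈log₂ n ⌉) step
  where
  step : ∀ n → (∀ {m} → m < n → m ≤ 2 ^ ⌈log₂ m ⌉) → n ≤ 2 ^ ⌈log₂ n ⌉
  step zero             _     = z≤n
  step (suc zero)       _     = s≤s z≤n
  step n@(suc (suc k)) below = begin
    n                                  ≡⟨ sym (⌊n/2⌋+⌈n/2⌉≡n n) ⟩
    ⌊ n /2⌋ + ⌈ n /2⌉                  ≤⟨ +-monoˡ-≤ ⌈ n /2⌉ (⌊n/2⌋≤⌈n/2⌉ n) ⟩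
    ⌈ n /2⌉ + ⌈ n /2⌉                  ≤⟨ +-mono-≤ half≤ half≤ ⟩
    2 ^ (t ∸ 1) + 2 ^ (t ∸ 1)          ≡⟨ cong (_+_ (2 ^ (t ∸ 1))) (sym (+-identityʳ _)) ⟩
    2 ^ suc (t ∸ 1)                    ≡⟨ cong (2 ^_) (m+[n∸m]≡n 1≤t) ⟩
    2 ^ t                              ∎
    where
    open ≤-Reasoning
    t : ℕ
    t = ⌈log₂ n ⌉
    1≤t : 1 ≤ t
    1≤t = ⌈log₂⌉-mono-≤ {2} {n} (s≤s (s≤s z≤n))
    half≤ : ⌈ n /2⌉ ≤ 2 ^ (t ∸ 1)
    half≤ = subst (λ e → ⌈ n /2⌉ ≤ 2 ^ e) (⌈log₂⌈n/2⌉⌉≡⌈log₂n⌉∸1 n) (below (⌈n/2⌉<n k))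

⌈log₂⌉-between : ∀ {k M} → 2 ^ k < M → M ≤ 2 ^ suc k → ⌈log₂ M ⌉ ≡ suc k
⌈log₂⌉-between {k} {M} 2^k<M M≤2^1+k = ≤-antisym
  (subst (⌈log₂ M ⌉ ≤_) (⌈log₂2^n⌉≡n (suc k)) (⌈log₂⌉-mono-≤ M≤2^1+k))
  (≰⇒> λ ⌈log₂M⌉≤k → <⇒≱ 2^k<M (≤-trans (n≤2^⌈log₂n⌉ M) (^-monoʳ-≤ 2 ⌈log₂M⌉≤k)))

2^m≤2^n⇒m≤n : ∀ {m n} → 2 ^ m ≤ 2 ^ n → m ≤ n
2^m≤2^n⇒m≤n {m} {n} 2^m≤2^n with m ≤? n
... | yes m≤n = m≤n
... | no  m≰n = ⊥-elim (<⇒≱ (^-monoʳ-< 2 ≤-refl (≰⇒> m≰n)) 2^m≤2^n)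

2^m*a≡2^n⇒a≡2^[n∸m] : ∀ m n {a} → 2 ^ m * a ≡ 2 ^ n → m ≤ n × a ≡ 2 ^ (n ∸ m)
2^m*a≡2^n⇒a≡2^[n∸m] m n {zero} eq = ⊥-elim (<⇒≢ (m^n>0 2 n) (trans (sym (*-zeroʳ (2 ^ m))) eq))
2^m*a≡2^n⇒a≡2^[n∸m] m n {a@(suc _)} eq =
  m≤n , *-cancelˡ-≡ a (2 ^ (n ∸ m)) (2 ^ m) {{m^n≢0 2 m}} 2^m*a≡2^m*2^[n∸m]
  where
  m≤n : m ≤ n
  m≤n = 2^m≤2^n⇒m≤n (subst (2 ^ m ≤_) eq (m≤m*n (2 ^ m) a))
  2^m*a≡2^m*2^[n∸m] : 2 ^ m * a ≡ 2 ^ m * 2 ^ (n ∸ m)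
  2^m*a≡2^m*2^[n∸m] = trans eq (trans (cong (2 ^_) (sym (m+[n∸m]≡n m≤n))) (^-distribˡ-+-* 2 m (n ∸ m)))

odd⇒coprime-2 : ∀ {x} → x % 2 ≡ 1 → Coprime x 2
odd⇒coprime-2 {x} x-odd (i∣x , i∣2) with irreducible[2] i∣2
... | inj₁ i≡1 = i≡1
... | inj₂ refl = ⊥-elim (0≢1+n (trans (sym (n∣m⇒m%n≡0 x 2 i∣x)) x-odd))

odd∣2^w*y⇒∣y : ∀ {x} → x % 2 ≡ 1 → ∀ w {y} → x ∣ 2 ^ w * y → x ∣ y
odd∣2^w*y⇒∣y {x} x-odd zero    {y} x∣y = subst (x ∣_) (*-identityˡ y) x∣y
odd∣2^w*y⇒∣y {x} x-odd (suc w) {y} x∣2^w*y = odd∣2^w*y⇒∣y x-odd w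
  (coprime-divisor (odd⇒coprime-2 x-odd) (subst (x ∣_) (*-assoc 2 (2 ^ w) y) x∣2^w*y))

x∣y∸1⇒y%x≡1 : ∀ {x y} .{{_ : NonZero x}} → 1 < x → 1 ≤ y → x ∣ y ∸ 1 → y % x ≡ 1
x∣y∸1⇒y%x≡1 {x} {y} 1<x 1≤y (divides q y∸1≡q*x) = begin
  y % x                  ≡⟨ cong (_% x) (sym (m+[n∸m]≡n 1≤y)) ⟩
  (1 + (y ∸ 1)) % x      ≡⟨ cong (λ e → (1 + e) % x) y∸1≡q*x ⟩
  (1 + q * x) % x        ≡⟨ [m+kn]%n≡m%n 1 q x ⟩
  1 % x                  ≡⟨ m<n⇒m%n≡m 1<x ⟩
  1                      ∎
  where open ≡-Reasoning

sumF-* : ∀ {n} c (a : Fin n → ℕ) → sumF (λ i → c * a i) ≡ c * sumF a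
sumF-* {zero}  c a = sym (*-zeroʳ c)
sumF-* {suc n} c a = trans (cong (_+_ (c * a zero)) (sumF-* c (a ∘ suc))) (sym (*-distribˡ-+ c (a zero) _))

≤sumF : ∀ {n} (a : Fin n → ℕ) i → a i ≤ sumF a
≤sumF a zero    = m≤m+n (a zero) _
≤sumF a (suc i) = ≤-trans (≤sumF (a ∘ suc) i) (m≤n+m _ (a zero))

+≤sumF : ∀ {n} (a : Fin n → ℕ) {i j} → i ≢ j → a i + a j ≤ sumF a
+≤sumF a {zero}  {zero}  i≢j = ⊥-elim (i≢j refl)
+≤sumF a {zero}  {suc j} _   = +-monoʳ-≤ (a zero) (≤sumF (a ∘ suc) j)
+≤sumF a {suc i} {zero}  _   =
  subst (_≤ sumF a) (+-comm (a zero) (a (suc i))) (+-monoʳ-≤ (a zero) (≤sumF (a ∘ suc) i))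
+≤sumF a {suc i} {suc j} i≢j = ≤-trans (+≤sumF (a ∘ suc) (i≢j ∘ cong suc)) (m≤n+m _ (a zero))

odd∧1<⇒2< : ∀ {x} → 1 < x → x % 2 ≡ 1 → 2 < x
odd∧1<⇒2< {suc zero}          (s≤s ()) _
odd∧1<⇒2< {suc (suc zero)}    _ ()
odd∧1<⇒2< {suc (suc (suc _))} _ _ = s≤s (s≤s (s≤s z≤n))

-- a single weight with gcd 1 is 1 = 2^0
gcdF≡1⇒sumF≢2^⇒2≤n : ∀ {n} (a : Fin n → ℕ) → gcdF a ≡ 1 → ¬ (∃[ k ] sumF a ≡ 2 ^ k) → 2 ≤ n
gcdF≡1⇒sumF≢2^⇒2≤n {zero}        a ()
gcdF≡1⇒sumF≢2^⇒2≤n {suc zero}    a gcd≡1 sum≢2^ =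
  ⊥-elim (sum≢2^ (0 , trans (+-identityʳ (a zero)) (trans (sym (gcd-identityʳ (a zero))) gcd≡1)))
gcdF≡1⇒sumF≢2^⇒2≤n {suc (suc n)} _ _ _ = s≤s (s≤s z≤n)

<sumF : ∀ {n} (a : Fin n → ℕ) → (∀ i → 0 < a i) → 2 ≤ n → ∀ i → a i < sumF a
<sumF {suc zero}    a a>0 (s≤s ()) i
<sumF {suc (suc n)} a a>0 _ i = <-≤-trans
  (subst (_≤ a i + a (other i)) (+-comm (a i) 1) (+-monoʳ-≤ (a i) (a>0 (other i))))
  (+≤sumF a (i≢other i))
  where
  other : Fin (suc (suc n)) → Fin (suc (suc n))
  other zero    = suc zero
  other (suc _) = zero
  i≢other : ∀ i → i ≢ other i
  i≢other zero    ()
  i≢other (suc _) ()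

-- Unrolled FLDR trees

1≤⋆ : ∀ {f g} → Nonneg f → Nonneg g → ∀ {p q}
  → + 1 ℤ.≤ f p → + 1 ℤ.≤ g q → + 1 ℤ.≤ (f ⋆ g) (p + q)
1≤⋆ {f} {g} f≥0 g≥0 {p} {q} 1≤fp 1≤gq = ℤ.≤-trans
  (1≤* 1≤fp (subst (λ e → + 1 ℤ.≤ g e) (sym (m+n∸m≡n p q)) 1≤gq))
  (term≤⋆ f≥0 g≥0 (m≤m+n p q))

1≤^ˢ : ∀ {g} → Nonneg g → ∀ {k} → g k ≡ + 1 → ∀ j → + 1 ℤ.≤ (g ^ˢ j) (j * k)
1≤^ˢ g≥0 gk≡1 zero    = ℤ.≤-refl
1≤^ˢ g≥0 gk≡1 (suc j) = 1≤⋆ g≥0 (^ˢ-nonneg g≥0 j) (ℤ.≤-reflexive (sym gk≡1)) (1≤^ˢ g≥0 gk≡1 j)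

-- depth p + s t is reached both through t loops of length s and through s loops of length t
two-paths : ∀ {f g} → Nonneg f → Nonneg g → ∀ {p s t} → f p ≡ + 1
  → 1 ≤ s → 1 ≤ t → s ≢ t → g s ≡ + 1 → g t ≡ + 1
  → + 2 ℤ.≤ Σ≤ (λ j → (f ⋆ (g ^ˢ j)) (p + s * t)) (p + s * t)
two-paths {f} {g} f≥0 g≥0 {p} {s} {t} fp≡1 1≤s 1≤t s≢t gs≡1 gt≡1 = ℤ.≤-trans
  (ℤ.+-mono-≤ (subst (λ e → + 1 ℤ.≤ (f ⋆ (g ^ˢ t)) (p + e)) (*-comm t s) (path gs≡1 t)) (path gt≡1 s))
  (distinct-terms≤Σ≤ (λ j → ⋆-nonneg f≥0 (^ˢ-nonneg g≥0 j) (p + s * t)) (s≢t ∘ sym)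
     (≤-trans (m≤n*m t s {{>-nonZero 1≤s}}) (m≤n+m (s * t) p))
     (≤-trans (m≤m*n s t {{>-nonZero 1≤t}}) (m≤n+m (s * t) p)))
  where
  path : ∀ {k} → g k ≡ + 1 → ∀ j → + 1 ℤ.≤ (f ⋆ (g ^ˢ j)) (p + j * k)
  path gk≡1 j = 1≤⋆ f≥0 (^ˢ-nonneg g≥0 j) (ℤ.≤-reflexive (sym fp≡1)) (1≤^ˢ g≥0 gk≡1 j)

module _ {n} (A : Fin n → ℕ) where
  open FLDR A

  unrolledLeaves-geometric : ∀ {ℓ} → F₀ ≗ z^ ℓ → ∀ i → unrolledLeaves i ≗ divOneMinusZ^ ℓ (F i)
  unrolledLeaves-geometric {ℓ} F₀≗z^ℓ i d =
    Σ≤-cong d (λ j _ → trans (⋆-congʳ (F i) (^ˢ-z^ ℓ F₀≗z^ℓ j) d) (⋆-z^ (j * ℓ) (F i) d))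

  M≤2^K′ : M ≤ 2 ^ K′
  M≤2^K′ = n≤2^⌈log₂n⌉ M

  odd∣M⇒0<A₀ : ∀ {x} → 1 < x → x % 2 ≡ 1 → x ∣ M → 0 < A₀
  odd∣M⇒0<A₀ {x} 1<x x-odd x∣M = m<n⇒0<n∸m (≤∧≢⇒< M≤2^K′ M≢2^K′)
    where
    M≢2^K′ : M ≢ 2 ^ K′
    M≢2^K′ M≡2^K′ = <⇒≢ 1<x (sym (∣1⇒≡1
      (odd∣2^w*y⇒∣y x-odd K′ (subst (x ∣_) (trans M≡2^K′ (sym (*-identityʳ _))) x∣M))))

  2^u∣M⇒2^u∣A₀ : ∀ {u} → 2 ^ u ≤ M → 2 ^ u ∣ M → 2 ^ u ∣ A₀
  2^u∣M⇒2^u∣A₀ {u} 2^u≤M 2^u∣M = ∣m+n∣m⇒∣n (subst (2 ^ u ∣_) 2^K′≡M+A₀ 2^u∣2^K′) 2^u∣M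
    where
    u≤K′ : u ≤ K′
    u≤K′ = 2^m≤2^n⇒m≤n (≤-trans 2^u≤M M≤2^K′)
    2^u∣2^K′ : 2 ^ u ∣ 2 ^ K′
    2^u∣2^K′ = subst (2 ^ u ∣_) (trans (sym (^-distribˡ-+-* 2 u (K′ ∸ u))) (cong (2 ^_) (m+[n∸m]≡n u≤K′)))
                     (m∣m*n _)
    2^K′≡M+A₀ : 2 ^ K′ ≡ M + A₀
    2^K′≡M+A₀ = trans (sym (m∸n+n≡m M≤2^K′)) (+-comm A₀ M)

  dyadic-backEdges⇒M≡ : ∀ {s} → 2 ^ s * A₀ ≡ 2 ^ K′ → M ≡ 2 ^ (K′ ∸ s) * (2 ^ s ∸ 1)
  dyadic-backEdges⇒M≡ {s} 2^s*A₀≡2^K′ = begin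
    M                                   ≡⟨ sym (m+n∸m≡n A₀ M) ⟩
    A₀ + M ∸ A₀                         ≡⟨ cong (_∸ A₀) (m∸n+n≡m M≤2^K′) ⟩
    2 ^ K′ ∸ A₀                         ≡⟨ cong₂ _∸_ 2^K′≡2^w*2^s A₀≡2^w ⟩
    2 ^ w * 2 ^ s ∸ 2 ^ w               ≡⟨ cong (2 ^ w * 2 ^ s ∸_) (sym (*-identityʳ (2 ^ w))) ⟩
    2 ^ w * 2 ^ s ∸ 2 ^ w * 1           ≡⟨ sym (*-distribˡ-∸ (2 ^ w) (2 ^ s) 1) ⟩
    2 ^ w * (2 ^ s ∸ 1)                 ∎
    where
    open ≡-Reasoning
    w : ℕ
    w = K′ ∸ s
    s≤K′×A₀≡2^w : s ≤ K′ × A₀ ≡ 2 ^ w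
    s≤K′×A₀≡2^w = 2^m*a≡2^n⇒a≡2^[n∸m] s K′ 2^s*A₀≡2^K′
    A₀≡2^w : A₀ ≡ 2 ^ w
    A₀≡2^w = proj₂ s≤K′×A₀≡2^w
    2^K′≡2^w*2^s : 2 ^ K′ ≡ 2 ^ w * 2 ^ s
    2^K′≡2^w*2^s = trans (cong (2 ^_) (sym (m∸n+n≡m (proj₁ s≤K′×A₀≡2^w)))) (^-distribˡ-+-* 2 w s)

  -- two distinct 1-digits of A₀ / 2^K′ would give two leaves labelled i at one depth
  backEdges-dyadic : ∀ i → 0 < A i → 0 < A₀ → (∀ d → unrolledLeaves i d ℤ.≤ + 1)
    → ∃[ s ] (1 ≤ s × 2 ^ s * A₀ ≡ 2 ^ K′)
  backEdges-dyadic i 0<Aᵢ 0<A₀ atMostOne =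
    single-one-digit⇒dyadic 0<A₀ A₀<2^K′ single
    where
    instance _ : NonZero (2 ^ K′)
    _ = m^n≢0 2 K′
    M<2^K′ : M < 2 ^ K′
    M<2^K′ = m∸n≢0⇒n<m (<⇒≢ 0<A₀ ∘ sym)
    A₀<2^K′ : A₀ < 2 ^ K′
    A₀<2^K′ = ∸-monoʳ-< {2 ^ K′} {M} {0} (≤-trans 0<Aᵢ (≤sumF A i)) (<⇒≤ M<2^K′)
    first : ∃[ d ] (1 ≤ d × 2 ^ d * A i / 2 ^ K′ ≡ 1)
    first = first-one-digit 0<Aᵢ (≤-<-trans (≤sumF A i) M<2^K′)
    p : ℕ
    p = proj₁ first
    Fᵢp≡1 : F i p ≡ + 1
    Fᵢp≡1 = cong +_ (ε≡1 {p} {A i} {2 ^ K′} (proj₂ (proj₂ first)))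
    single : ∀ s t → 1 ≤ s → 1 ≤ t → ε s A₀ (2 ^ K′) ≡ 1 → ε t A₀ (2 ^ K′) ≡ 1 → s ≡ t
    single s t 1≤s 1≤t εs≡1 εt≡1 with s ≟ t
    ... | yes s≡t = s≡t
    ... | no  s≢t = ⊥-elim (<⇒≱ (s≤s (s≤s z≤n)) (ℤ.drop‿+≤+ (ℤ.≤-trans
            (two-paths (digits-nonneg (A i) (2 ^ K′)) (digits-nonneg A₀ (2 ^ K′)) Fᵢp≡1 1≤s 1≤t s≢t
                       (cong +_ εs≡1) (cong +_ εt≡1))
            (atMostOne (p + s * t)))))

module Theorem5p6 {n} (a : Fin n → ℕ) (a>0 : ∀ i → 0 < a i) (gcd≡1 : gcdF a ≡ 1)
  (sum≢2^ : ¬ (∃[ k ] sumF a ≡ 2 ^ k)) (u x′ ℓ : ℕ) (m≡2^u*x : sumF a ≡ 2 ^ u * suc x′)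
  (1<x : 1 < suc x′) (x-odd : suc x′ % 2 ≡ 1) (ord : IsOrder2 (suc x′) ℓ) where

  x m L c : ℕ
  x = suc x′
  m = sumF a
  L = u + ℓ
  c = cK L m

  1≤ℓ : 1 ≤ ℓ
  1≤ℓ = proj₁ ord

  2^ℓ%x≡1 : 2 ^ ℓ % x ≡ 1
  2^ℓ%x≡1 = proj₁ (proj₂ ord)

  2^u<m : 2 ^ u < m
  2^u<m = subst (_< m) (*-identityʳ (2 ^ u))
                (subst (2 ^ u * 1 <_) (sym m≡2^u*x) (*-monoʳ-< (2 ^ u) {{m^n≢0 2 u}} 1<x))

  instance
    m≢0 : NonZero m
    m≢0 = >-nonZero (≤-<-trans z≤n 2^u<m)

  2≤ℓ : 2 ≤ ℓ
  2≤ℓ with ℓ ≟ 1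
  ... | no  ℓ≢1 = ≤∧≢⇒< 1≤ℓ (ℓ≢1 ∘ sym)
  ... | yes refl with trans (sym (m<n⇒m%n≡m (odd∧1<⇒2< 1<x x-odd))) 2^ℓ%x≡1
  ...   | ()

  2^L≡c*m+2^u : 2 ^ L ≡ c * m + 2 ^ u
  2^L≡c*m+2^u = trans 2^L≡k*m+2^u (cong (λ e → e * m + 2 ^ u) (sym c≡k))
    where
    k : ℕ
    k = 2 ^ ℓ / x
    2^L≡k*m+2^u : 2 ^ L ≡ k * m + 2 ^ u
    2^L≡k*m+2^u = begin
      2 ^ (u + ℓ)                  ≡⟨ ^-distribˡ-+-* 2 u ℓ ⟩
      2 ^ u * 2 ^ ℓ                ≡⟨ cong (2 ^ u *_) 2^ℓ≡1+k*x ⟩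
      2 ^ u * (1 + k * x)          ≡⟨ rearrange (2 ^ u) k x ⟩
      k * (2 ^ u * x) + 2 ^ u      ≡⟨ cong (λ e → k * e + 2 ^ u) (sym m≡2^u*x) ⟩
      k * m + 2 ^ u                ∎
      where
      open ≡-Reasoning
      2^ℓ≡1+k*x : 2 ^ ℓ ≡ 1 + k * x
      2^ℓ≡1+k*x = trans (m≡m%n+[m/n]*n (2 ^ ℓ) x) (cong (_+ k * x) 2^ℓ%x≡1)
      rearrange : ∀ p k x → p * (1 + k * x) ≡ k * (p * x) + p
      rearrange = ℕ-solve-∀
    c≡k : c ≡ k
    c≡k = begin
      c                            ≡⟨ cK-nonZero L m ⟩
      2 ^ L / m                    ≡⟨ cong (_/ m) 2^L≡k*m+2^u ⟩
      (k * m + 2 ^ u) / m          ≡⟨ [k*n+m]/n≡k+m/n k (2 ^ u) m ⟩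
      k + 2 ^ u / m                ≡⟨ cong (_+_ k) (m<n⇒m/n≡0 2^u<m) ⟩
      k + 0                        ≡⟨ +-identityʳ k ⟩
      k                            ∎
      where open ≡-Reasoning

  instance
    2^L≢0 : NonZero (2 ^ L)
    2^L≢0 = m^n≢0 2 L

  2≤n : 2 ≤ n
  2≤n = gcdF≡1⇒sumF≢2^⇒2≤n a gcd≡1 sum≢2^

  a<m : ∀ i → a i < m
  a<m = <sumF a a>0 2≤n

  1≤c : 1 ≤ c
  1≤c = n≢0⇒n>0 λ c≡0 → <⇒≢ 2^u<2^L (sym (trans 2^L≡c*m+2^u (cong (λ e → e * m + 2 ^ u) c≡0)))
    where
    2^u<2^L : 2 ^ u < 2 ^ L
    2^u<2^L = ^-monoʳ-< 2 ≤-refl (subst (_≤ L) (+-comm u 1) (+-monoʳ-≤ u 1≤ℓ))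

  c*m<2^L : c * m < 2 ^ L
  c*m<2^L = subst (c * m <_) (sym 2^L≡c*m+2^u) (m<m+n (c * m) (m^n>0 2 u))

  ⌈log₂m⌉≤L : ⌈log₂ m ⌉ ≤ L
  ⌈log₂m⌉≤L = subst (⌈log₂ m ⌉ ≤_) (⌈log₂2^n⌉≡n L)
    (⌈log₂⌉-mono-≤ (≤-trans (m≤n*m m c {{>-nonZero 1≤c}}) (<⇒≤ c*m<2^L)))

  Optimal : ℕ → Set
  Optimal = ALDR-EntropyOptimal a

  E : Fin n → Series
  E i = digits (a i) m

  OptimalForSomeK ExactCoefficients NonnegCoefficients MonotoneDigits : Set
  OptimalForSomeK    = ∃[ K ] (⌈log₂ m ⌉ ≤ K × K ≤ L × Optimal K)
  ExactCoefficients  = ∀ i → oneMinusZ^ ℓ ⋆ E i ≗ digits (c * a i) (2 ^ L)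
  NonnegCoefficients = ∀ i → Nonneg (oneMinusZ^ ℓ ⋆ E i)
  MonotoneDigits     = ∀ d i → 1 ≤ d → ε d (a i) m ≤ ε (d + ℓ) (a i) m

  module ALDR-L = FLDR (λ i → c * a i)

  ALDR-L-M≡c*m : ALDR-L.M ≡ c * m
  ALDR-L-M≡c*m = sumF-* c a

  ALDR-L-K′≡L : ALDR-L.K′ ≡ L
  ALDR-L-K′≡L = trans
    (⌈log₂⌉-between {L ∸ 1} (subst (2 ^ (L ∸ 1) <_) (sym ALDR-L-M≡c*m) 2^[L∸1]<c*m) M≤2^[1+[L∸1]])
    (m+[n∸m]≡n 1≤L)
    where
    1≤L : 1 ≤ L
    1≤L = ≤-trans 1≤ℓ (m≤n+m ℓ u)
    M≤2^[1+[L∸1]] : ALDR-L.M ≤ 2 ^ suc (L ∸ 1)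
    M≤2^[1+[L∸1]] = subst₂ _≤_ (sym ALDR-L-M≡c*m) (cong (2 ^_) (sym (m+[n∸m]≡n 1≤L))) (<⇒≤ c*m<2^L)
    -- 2^L = c m + 2^u with 2^u < 2^(L-1) because ℓ ≥ 2
    2^[L∸1]<c*m : 2 ^ (L ∸ 1) < c * m
    2^[L∸1]<c*m = +-cancelʳ-< (2 ^ u) (2 ^ (L ∸ 1)) (c * m) (begin-strict
      2 ^ (L ∸ 1) + 2 ^ u               <⟨ +-monoʳ-< (2 ^ (L ∸ 1)) (^-monoʳ-< 2 ≤-refl u<L∸1) ⟩
      2 ^ (L ∸ 1) + 2 ^ (L ∸ 1)         ≡⟨ cong (_+_ (2 ^ (L ∸ 1))) (sym (+-identityʳ _)) ⟩
      2 ^ suc (L ∸ 1)                   ≡⟨ cong (2 ^_) (m+[n∸m]≡n 1≤L) ⟩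
      2 ^ L                             ≡⟨ 2^L≡c*m+2^u ⟩
      c * m + 2 ^ u                     ∎)
      where
      open ≤-Reasoning
      u<L∸1 : u < L ∸ 1
      u<L∸1 = subst (u <_) (sym (+-∸-assoc u 1≤ℓ))
                    (subst (_≤ u + (ℓ ∸ 1)) (+-comm u 1) (+-monoʳ-≤ u (∸-monoˡ-≤ 1 2≤ℓ)))

  ALDR-L-A₀≡2^u : ALDR-L.A₀ ≡ 2 ^ u
  ALDR-L-A₀≡2^u = begin
    2 ^ ALDR-L.K′ ∸ ALDR-L.M       ≡⟨ cong₂ (λ K M → 2 ^ K ∸ M) ALDR-L-K′≡L ALDR-L-M≡c*m ⟩
    2 ^ L ∸ c * m            ≡⟨ cong (_∸ c * m) 2^L≡c*m+2^u ⟩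
    c * m + 2 ^ u ∸ c * m    ≡⟨ m+n∸m≡n (c * m) (2 ^ u) ⟩
    2 ^ u                    ∎
    where open ≡-Reasoning

  ALDR-L-leaves : ∀ i → ALDR-L.unrolledLeaves i ≗ divOneMinusZ^ ℓ (digits (c * a i) (2 ^ L))
  ALDR-L-leaves i d = trans (unrolledLeaves-geometric (λ i → c * a i) F₀≗z^ℓ i d)
                            (divOneMinusZ^-cong ℓ Fᵢ≗ d)
    where
    F₀≗z^ℓ : ALDR-L.F₀ ≗ z^ ℓ
    F₀≗z^ℓ k = trans (cong₂ (λ A K → + ε k A (2 ^ K)) ALDR-L-A₀≡2^u ALDR-L-K′≡L) (digits-2^ u ℓ k)
    Fᵢ≗ : ALDR-L.F i ≗ digits (c * a i) (2 ^ L)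
    Fᵢ≗ k = cong (λ K → + ε k (c * a i) (2 ^ K)) ALDR-L-K′≡L

  optimal-L⇔exact : Optimal L ⇔ ExactCoefficients
  optimal-L⇔exact = mk⇔
    (λ opt i → Equivalence.to (geometric i) (λ d → trans (sym (ALDR-L-leaves i d)) (opt i d)))
    (λ exact i d → trans (ALDR-L-leaves i d) (Equivalence.from (geometric i) (exact i) d))
    where
    geometric : ∀ i → (divOneMinusZ^ ℓ (digits (c * a i) (2 ^ L)) ≗ E i)
                      ⇔ (oneMinusZ^ ℓ ⋆ E i ≗ digits (c * a i) (2 ^ L))
    geometric i = divOneMinusZ^-⇔ 1≤ℓ (digits (c * a i) (2 ^ L)) (E i)

  -- the coefficients of (1 - z^ℓ) E i are bits spelling ⌊2^D a_i / m⌋ - ⌊2^(D-ℓ) a_i / m⌋,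
  -- which equals ⌊2^D c a_i / 2^L⌋ as soon as D ≥ L
  nonneg⇒exact : NonnegCoefficients → ExactCoefficients
  nonneg⇒exact nonneg i d = trans (oneMinusZ^-⋆ ℓ (E i) d)
    (accumulates-unique {e = C} {w = Z} {w′ = v} L Z-acc v-acc C-bit (digits-isBit N (2 ^ L)) agree d)
    where
    A N : ℕ
    A = a i
    N = c * A
    w v : Series
    w = prefixValue A m
    v = prefixValue N (2 ^ L)
    w-acc : Accumulates (E i) w
    w-acc = prefixValue-accumulates (a<m i)
    C Z : Series
    C D = E i D ℤ.- shift ℓ (E i) D
    Z D = w D ℤ.- shift ℓ w D
    Z-acc : Accumulates C Z
    Z-acc = -‿accumulates {E i} {shift ℓ (E i)} {w} {shift ℓ w} w-acc (shift-accumulates ℓ w-acc)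
    N<2^L : N < 2 ^ L
    N<2^L = ≤-<-trans (*-monoʳ-≤ c (<⇒≤ (a<m i))) c*m<2^L
    v-acc : Accumulates (digits N (2 ^ L)) v
    v-acc = prefixValue-accumulates N<2^L
    C-bit : ∀ d → IsBit (C d)
    C-bit d = 0≤b≤1⇒IsBit (subst (0ℤ ℤ.≤_) (oneMinusZ^-⋆ ℓ (E i) d) (nonneg i d))
      (ℤ.≤-trans (ℤ.+-monoʳ-≤ (E i d) (ℤ.neg-mono-≤ (shift-nonneg ℓ (digits-nonneg A m) d)))
                 (ℤ.≤-trans (ℤ.≤-reflexive (ℤ.+-identityʳ (E i d))) (+≤+ (ε≤1 d A m))))
    agree : ∀ t → Z (L + t) ≡ v (L + t)
    agree t = begin
      w (L + t) ℤ.- shift ℓ w (L + t)            ≡⟨ cong₂ ℤ._-_ w-top shift-top ⟩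
      + (2 ^ t * N + Y) ℤ.- + Y                  ≡⟨ cong (ℤ._- + Y) (ℤ.pos-+ (2 ^ t * N) Y) ⟩
      + (2 ^ t * N) ℤ.+ + Y ℤ.- + Y              ≡⟨ i+j-j≡i (+ (2 ^ t * N)) (+ Y) ⟩
      + (2 ^ t * N)                              ≡⟨ cong +_ (sym (m*n/n≡m (2 ^ t * N) (2 ^ L))) ⟩
      + (2 ^ t * N * 2 ^ L / 2 ^ L)              ≡⟨ cong (λ e → + (e / 2 ^ L)) (sym 2^[L+t]*N≡) ⟩
      v (L + t)                                  ∎
      where
      open ≡-Reasoning
      Y : ℕ
      Y = 2 ^ (u + t) * A / m
      shift-top : shift ℓ w (L + t) ≡ + Y
      shift-top = trans (shift-≤ w (≤-trans (m≤n+m ℓ u) (m≤m+n L t)))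
                        (cong w (trans (cong (_∸ ℓ) (swap u ℓ t)) (m+n∸n≡m (u + t) ℓ)))
        where
        swap : ∀ u ℓ t → u + ℓ + t ≡ u + t + ℓ
        swap = ℕ-solve-∀
      2^[L+t]*N≡ : 2 ^ (L + t) * N ≡ 2 ^ t * N * 2 ^ L
      2^[L+t]*N≡ = trans (cong (_* N) (^-distribˡ-+-* 2 L t)) (swap (2 ^ L) (2 ^ t) N)
        where
        swap : ∀ b p n → b * p * n ≡ p * n * b
        swap = ℕ-solve-∀
      w-top : w (L + t) ≡ + (2 ^ t * N + Y)
      w-top = cong +_ (trans (cong (_/ m) numerator) ([k*n+m]/n≡k+m/n (2 ^ t * N) (2 ^ (u + t) * A) m))
        where
        rearrange : ∀ p U c m A → (c * m + U) * p * A ≡ p * (c * A) * m + U * p * A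
        rearrange = ℕ-solve-∀
        numerator : 2 ^ (L + t) * A ≡ 2 ^ t * N * m + 2 ^ (u + t) * A
        numerator = begin
          2 ^ (L + t) * A                     ≡⟨ cong (_* A) (^-distribˡ-+-* 2 L t) ⟩
          2 ^ L * 2 ^ t * A                   ≡⟨ cong (λ e → e * 2 ^ t * A) 2^L≡c*m+2^u ⟩
          (c * m + 2 ^ u) * 2 ^ t * A         ≡⟨ rearrange (2 ^ t) (2 ^ u) c m A ⟩
          2 ^ t * N * m + 2 ^ u * 2 ^ t * A   ≡⟨ cong (λ e → 2 ^ t * N * m + e * A) (sym (^-distribˡ-+-* 2 u t)) ⟩
          2 ^ t * N * m + 2 ^ (u + t) * A     ∎

  ℓ-minimal : ∀ {s} → 1 ≤ s → 2 ^ s % x ≡ 1 → ℓ ≤ s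
  ℓ-minimal {s} 1≤s 2^s%x≡1 with ℓ ≤? s
  ... | yes ℓ≤s = ℓ≤s
  ... | no  ℓ≰s = ⊥-elim (proj₂ (proj₂ ord) s 1≤s (≰⇒> ℓ≰s) 2^s%x≡1)

  -- optimality forces the back edges of ALDR[P,K] to form a single loop of length s,
  -- so that its total weight is M = 2^w (2^s - 1) with K′ = w + s; then x ∣ M and 2^u ∣ M
  optimal⇒L≤K : ∀ K → ⌈log₂ m ⌉ ≤ K → Optimal K → L ≤ K
  optimal⇒L≤K K ⌈log₂m⌉≤K opt = ≤-trans (subst (L ≤_) (m∸n+n≡m s≤K′) (+-mono-≤ u≤w ℓ≤s)) K′≤K
    where
    d : ℕ
    d = cK K m
    open FLDR (λ i → d * a i) using (M; K′; A₀)
    1≤d : 1 ≤ d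
    1≤d = subst (1 ≤_) (sym (cK-nonZero K m))
                (m≥n⇒m/n>0 (≤-trans (n≤2^⌈log₂n⌉ m) (^-monoʳ-≤ 2 ⌈log₂m⌉≤K)))
    M≡d*m : M ≡ d * m
    M≡d*m = sumF-* d a
    K′≤K : K′ ≤ K
    K′≤K = subst (K′ ≤_) (⌈log₂2^n⌉≡n K) (⌈log₂⌉-mono-≤ M≤2^K)
      where
      M≤2^K : M ≤ 2 ^ K
      M≤2^K = subst (_≤ 2 ^ K) (sym (trans M≡d*m (cong (_* m) (cK-nonZero K m)))) (m/n*n≤m (2 ^ K) m)
    x∣M : x ∣ M
    x∣M = subst (x ∣_) (sym M≡d*m) (∣n⇒∣m*n d (subst (x ∣_) (sym m≡2^u*x) (n∣m*n (2 ^ u))))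
    2^u∣M : 2 ^ u ∣ M
    2^u∣M = subst (2 ^ u ∣_) (sym M≡d*m) (∣n⇒∣m*n d (subst (2 ^ u ∣_) (sym m≡2^u*x) (m∣m*n x)))
    i₀ : Fin n
    i₀ = fromℕ< (≤-trans (s≤s z≤n) 2≤n)
    loop : ∃[ s ] (1 ≤ s × 2 ^ s * A₀ ≡ 2 ^ K′)
    loop = backEdges-dyadic (λ i → d * a i) i₀ (*-mono-≤ 1≤d (a>0 i₀))
             (odd∣M⇒0<A₀ (λ i → d * a i) 1<x x-odd x∣M)
             (λ e → subst (ℤ._≤ + 1) (sym (opt i₀ e)) (+≤+ (ε≤1 e (a i₀) m)))
    s w : ℕ
    s = proj₁ loop
    w = K′ ∸ s
    2^s*A₀≡2^K′ : 2 ^ s * A₀ ≡ 2 ^ K′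
    2^s*A₀≡2^K′ = proj₂ (proj₂ loop)
    s≤K′×A₀≡2^w : s ≤ K′ × A₀ ≡ 2 ^ w
    s≤K′×A₀≡2^w = 2^m*a≡2^n⇒a≡2^[n∸m] s K′ 2^s*A₀≡2^K′
    s≤K′ : s ≤ K′
    s≤K′ = proj₁ s≤K′×A₀≡2^w
    ℓ≤s : ℓ ≤ s
    ℓ≤s = ℓ-minimal (proj₁ (proj₂ loop)) (x∣y∸1⇒y%x≡1 1<x (m^n>0 2 s) (odd∣2^w*y⇒∣y x-odd w
            (subst (x ∣_) (dyadic-backEdges⇒M≡ (λ i → d * a i) {s} 2^s*A₀≡2^K′) x∣M)))
    u≤w : u ≤ w
    u≤w = 2^m≤2^n⇒m≤n (∣⇒≤ {{m^n≢0 2 w}} (subst (2 ^ u ∣_) (proj₂ s≤K′×A₀≡2^w)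
            (2^u∣M⇒2^u∣A₀ (λ i → d * a i) {u} 2^u≤M 2^u∣M)))
      where
      2^u≤M : 2 ^ u ≤ M
      2^u≤M = ≤-trans (<⇒≤ 2^u<m) (subst (m ≤_) (sym M≡d*m) (m≤n*m m d {{>-nonZero 1≤d}}))

  1⇔2 : OptimalForSomeK ⇔ Optimal L
  1⇔2 = mk⇔
    (λ (K , ⌈log₂m⌉≤K , K≤L , opt) → subst Optimal (≤-antisym K≤L (optimal⇒L≤K K ⌈log₂m⌉≤K opt)) opt)
    (λ opt → L , ⌈log₂m⌉≤L , ≤-refl , opt)

  exact⇔nonneg : ExactCoefficients ⇔ NonnegCoefficients
  exact⇔nonneg = mk⇔ (λ exact i d → subst (0ℤ ℤ.≤_) (sym (exact i d)) (+≤+ z≤n)) nonneg⇒exact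

  nonneg⇔monotone : NonnegCoefficients ⇔ MonotoneDigits
  nonneg⇔monotone = mk⇔ (λ nonneg d i → Equivalence.to (digitwise i) (nonneg i) d)
                        (λ monotone i → Equivalence.from (digitwise i) (λ d → monotone d i))
    where
    digitwise : ∀ i → Nonneg (oneMinusZ^ ℓ ⋆ E i)
                      ⇔ (∀ d → 1 ≤ d → ε d (a i) m ≤ ε (d + ℓ) (a i) m)
    digitwise i = oneMinusZ^-nonneg⇔ ℓ (λ d → ε d (a i) m) (ε0≡0 (a<m i))

theorem5p6 : (n : ℕ) (a : Fin n → ℕ) → (∀ i → 0 < a i) → gcdF a ≡ 1
    → ¬ (∃[ k ] sumF a ≡ 2 ^ k)
    → (u x ℓ : ℕ) → sumF a ≡ 2 ^ u * x → 1 < x → x % 2 ≡ 1 → IsOrder2 x ℓ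
    → ((∃[ K ] (⌈log₂ sumF a ⌉ ≤ K × K ≤ u + ℓ × ALDR-EntropyOptimal a K))
         ⇔ ALDR-EntropyOptimal a (u + ℓ))
      × ((∃[ K ] (⌈log₂ sumF a ⌉ ≤ K × K ≤ u + ℓ × ALDR-EntropyOptimal a K))
         ⇔ (∀ (i : Fin n) (d : ℕ) → (oneMinusZ^ ℓ ⋆ digits (a i) (sumF a)) d
              ≡ digits (cK (u + ℓ) (sumF a) * a i) (2 ^ (u + ℓ)) d))
      × ((∃[ K ] (⌈log₂ sumF a ⌉ ≤ K × K ≤ u + ℓ × ALDR-EntropyOptimal a K))
         ⇔ (∀ (i : Fin n) (d : ℕ) → + 0 ℤ.≤ (oneMinusZ^ ℓ ⋆ digits (a i) (sumF a)) d))
      × ((∃[ K ] (⌈log₂ sumF a ⌉ ≤ K × K ≤ u + ℓ × ALDR-EntropyOptimal a K))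
         ⇔ (∀ (d : ℕ) (i : Fin n) → 1 ≤ d → ε d (a i) (sumF a) ≤ ε (d + ℓ) (a i) (sumF a)))
theorem5p6 n a a>0 gcd≡1 sum≢2^ u zero     ℓ _ () _ _
theorem5p6 n a a>0 gcd≡1 sum≢2^ u (suc x′) ℓ m≡2^u*x 1<x x-odd ord =
  1⇔2 , 1⇔3 , 1⇔4 , ⇔.trans 1⇔4 nonneg⇔monotone
  where
  open Theorem5p6 a a>0 gcd≡1 sum≢2^ u x′ ℓ m≡2^u*x 1<x x-odd ord
  1⇔3 : OptimalForSomeK ⇔ ExactCoefficients
  1⇔3 = ⇔.trans 1⇔2 optimal-L⇔exact
  1⇔4 : OptimalForSomeK ⇔ NonnegCoefficients
  1⇔4 = ⇔.trans 1⇔3 exact⇔nonneg
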